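{- Let $G$ be a graph, and let $f:V(G)\to\mathbb{N}$ satisfy $\sum_{v\in V(G)}f(v)=|V(G)|+|E(G)|$. Let $t$ be a prime power and let $P$ be a list assignment of $G$ such that $|P(v)|=f(v)$ and $P(v)\subseteq\mathbb{F}_t$ for each $v\in V(G)$. If there is a unique proper $P$-coloring of $G$, then there is an $\mathcal{H}$-coloring of $G$ for every good prime $f$-cover $\mathcal{H}$ of $G$ of order $t$.
   Context: All graphs are finite and simple. A list assignment $P$ assigns to each vertex $v$ a set $P(v)$; a proper $P$-coloring is a map $c$ with $c(v)\in P(v)$ for all $v$ and $c(u)\neq c(v)$ for adjacent $u,v$. A cover of a graph $G$ is a pair $\mathcal{H}=(L,H)$ where $H$ is a graph and $L:V(G)\to\mathcal{P}(V(H))$ satisfies: (1) $\{L(u)\}$ partitions $V(H)$; (2) each $H[L(u)]$ is complete; (3) if $E_H(L(u),L(v))\neq\emptyset$ then $u=v$ or $uv\in E(G)$; (4) if $uv\in E(G)$ then $E_H(L(u),L(v))$ is a matching (possibly empty). An $\mathcal{H}$-coloring is an independent set of $H$ of size $|V(G)|$. $\mathcal{H}$ is an $f$-cover if $|L(u)|=f(u)$ for all $u$. For a prime power $t$, a prime cover of order $t$ is a cover with $|L(v)|\le t$ for all $v$, with vertices named so that $L(v)\subseteq\{(v,j):j\in\mathbb{F}_t\}$. Fix an ordering $v_1,\dots,v_n$ of the vertices. For an edge $v_iv_j$, $j>i$, the saturation function $\sigma_{v_iv_j}$ maps each $q$ with $(v_i,q)$ saturated by $E_H(L(v_i),L(v_j))$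 to the unique $r$ with $(v_i,q)(v_j,r)\in E(H)$; it is good if $q-\sigma_{v_iv_j}(q)$ is the same element of $\mathbb{F}_t$ for all $q$ in its domain (vacuously good if empty). The prime cover is good if some such naming makes every saturation function good. -}

module Defs where

open import Data.Nat as ℕ using (ℕ; suc; _^_)
open import Data.Nat.Primality using (Prime)
open import Data.Bool using (Bool; true; false; if_then_else_; _∧_)
open import Data.Fin as Fin using (Fin; _<_; _<?_)
open import Data.Fin.Subset using (Subset; _∈_; ∣_∣)
open import Data.List using (List; map; allFin; length)
open import Data.Nat.ListAction using (sum)
open import Data.List.Membership.Propositional as LM using ()
open import Data.List.Relation.Unary.All using (All)
open import Data.List.Relation.Unary.Unique.Propositional using (Unique)
open import Data.Product using (Σ; ∃; _×_; _,_)
open import Relation.Nullary using (¬_; does)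
open import Relation.Binary.PropositionalEquality using (_≡_; _≢_)
open import Algebra.Core using (Op₁; Op₂)
import Algebra.Structures as AS
open import Function.Definitions using (Injective)
open import Level using (0ℓ)

IsPrimePower : ℕ → Set
IsPrimePower t = Σ ℕ λ p → Σ ℕ λ k → Prime p × t ≡ p ^ suc k

-- A finite field of order t, with carrier Fin t (every finite field of
-- order t is isomorphic to one of these; F_t is unique up to iso).

record FiniteField (t : ℕ) : Set where
  field
    _+F_ : Op₂ (Fin t)
    _*F_ : Op₂ (Fin t)
    -F_  : Op₁ (Fin t)
    0F   : Fin t
    1F   : Fin t
    isCommutativeRing : AS.IsCommutativeRing {A = Fin t} _≡_ _+F_ _*F_ -F_ 0F 1F
    0≢1  : 0F ≢ 1F
    inverse : ∀ x → x ≢ 0F → Σ (Fin t) λ y → x *F y ≡ 1F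

  _-F_ : Op₂ (Fin t)
  x -F y = x +F (-F y)

-- Finite simple graphs on vertex set Fin n (ordering v_1,…,v_n is the
-- natural order of Fin n).

record Graph (n : ℕ) : Set where
  field
    adj       : Fin n → Fin n → Bool
    adj-sym   : ∀ u v → adj u v ≡ adj v u
    adj-irref : ∀ v → adj v v ≡ false

edgeCount : ∀ {n} → Graph n → ℕ
edgeCount {n} G =
  sum (map (λ i → sum (map (λ j → if does (i <? j) ∧ Graph.adj G i j then 1 else 0)
                          (allFin n)))
           (allFin n))

sumF : ∀ {n} → (Fin n → ℕ) → ℕ
sumF {n} f = sum (map f (allFin n))

ListAssignment : ℕ → ℕ → Set
ListAssignment n t = Fin n → Subset t

IsProperColoring : ∀ {n t} → Graph n → ListAssignment n t → (Fin n → Fin t) → Set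
IsProperColoring G P c =
  (∀ v → c v ∈ P v) × (∀ u v → Graph.adj G u v ≡ true → c u ≢ c v)

HasUniqueProperColoring : ∀ {n t} → Graph n → ListAssignment n t → Set
HasUniqueProperColoring {n} {t} G P =
  Σ (Fin n → Fin t) λ c → IsProperColoring G P c ×
    (∀ c′ → IsProperColoring G P c′ → ∀ v → c′ v ≡ c v)

-- Prime covers of order t.  The vertices of H are the named pairs (v , j)
-- with j ∈ L v ⊆ F_t = Fin t; conditions (1)-(4) of a cover, plus H simple.

record PrimeCover {n : ℕ} (G : Graph n) (t : ℕ) : Set where
  field
    L    : Fin n → Subset t
    adjH : Fin n → Fin t → Fin n → Fin t → Bool
    adjH-vert  : ∀ u a v b → adjH u a v b ≡ true → a ∈ L u × b ∈ L v
    adjH-sym   : ∀ u a v b → adjH u a v b ≡ adjH v b u a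
    adjH-irref : ∀ u a → adjH u a u a ≡ false
    complete   : ∀ u a b → a ∈ L u → b ∈ L u → a ≢ b → adjH u a u b ≡ true
    over-edges : ∀ u a v b → adjH u a v b ≡ true → u ≢ v → Graph.adj G u v ≡ true
    matching   : ∀ u a v b b′ → u ≢ v → adjH u a v b ≡ true → adjH u a v b′ ≡ true → b ≡ b′

  Vertex : Set
  Vertex = Fin n × Fin t

  InH : Vertex → Set
  InH (v , j) = j ∈ L v

  AdjH : Vertex → Vertex → Bool
  AdjH (u , a) (v , b) = adjH u a v b

open PrimeCover public using ()

IsFCover : ∀ {n t} {G : Graph n} → PrimeCover G t → (Fin n → ℕ) → Set
IsFCover {n} H f = ∀ v → ∣ PrimeCover.L H v ∣ ≡ f v

-- Good: some renaming (an injective, hence bijective, renaming ρ v of the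
-- names at each vertex v) makes every saturation function good: for every
-- edge v_i v_j (i < j) there is d ∈ F_t with q − σ(q) = d for all q in the
-- domain of σ_{v_i v_j}.
IsGood : ∀ {n t} {G : Graph n} → FiniteField t → PrimeCover G t → Set
IsGood {n} {t} {G} F H =
  Σ (Fin n → Fin t → Fin t) λ ρ →
    (∀ v → Injective _≡_ _≡_ (ρ v)) ×
    (∀ u v → u < v → Graph.adj G u v ≡ true →
       Σ (Fin t) λ d → ∀ q r → PrimeCover.adjH H u q v r ≡ true →
         FiniteField._-F_ F (ρ u q) (ρ v r) ≡ d)

IsHColoring : ∀ {n t} {G : Graph n} → PrimeCover G t → List (Fin n × Fin t) → Set
IsHColoring {n} H S =
  Unique S ×
  All (PrimeCover.InH H) S ×
  (∀ x y → x LM.∈ S → y LM.∈ S → PrimeCover.AdjH H x y ≡ false) ×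
  length S ≡ n

HasHColoring : ∀ {n t} {G : Graph n} → PrimeCover G t → Set
HasHColoring {n} {t} H = Σ (List (Fin n × Fin t)) λ S → IsHColoring H S

-- For k + 1 distinct field elements A, the divided difference ∑_{a ∈ A} a ^ j / ∏_{b ∈ A, b ≠ a} (a − b)
-- vanishes for j < k and is 1 for j = k.  So if the lists A_v have k_v + 1 distinct elements and
-- ∑ k_v = |E|, the weighted grid sum ∑_{x ∈ ∏ A_v} Q(x) ∏_v 1 / ∏_{b ∈ A_v, b ≠ x_v} (x_v − b) of a
-- polynomial Q of degree at most |E| is its coefficient of ∏ x_v ^ k_v (Combinatorial Nullstellensatz).
-- For Q_d(x) = ∏_{uv ∈ E, u < v} (x_u − x_v − d_uv) this coefficient does not depend on d.  On the lists
-- P(v) with d = 0 the sum has a single nonzero term, at the unique proper P-colouring, since Q_0 vanishes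
-- at every improper colouring.  So on the lists L(v) renamed by the good naming, with d_uv the constant
-- difference of the saturation function of uv, some grid point x has Q_d(x) ≠ 0.  Reading x back through
-- the naming picks one vertex of H in each L(v), and two of them adjacent at u < v would force
-- x_u − x_v = d_uv.

module Submission where

open import Defs
open import Algebra.Bundles using (CommutativeRing; Semiring)
open import Data.Bool as Bool using (Bool; true; false; if_then_else_; _∧_)
open import Data.Bool.Properties using (∧-conicalˡ; ∧-conicalʳ)
open import Data.Empty using (⊥-elim)
open import Data.Fin using (Fin; zero; suc; _<_; _<?_; _≟_)
import Data.Fin.Properties as Fin
open import Data.Fin.Subset using (Subset; inside; outside; ∣_∣) renaming (_∈_ to _∈ₛ_)
open import Data.List using (List; []; _∷_; length; map; concatMap; allFin; tabulate)
open import Data.List.Membership.Propositional using (_∈_)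
open import Data.List.Membership.Propositional.Properties using (∈-map⁺; ∈-map⁻; ∈-concat⁺′; ∈-concat⁻′; ∈-allFin)
open import Data.List.Properties using (length-map; length-++; length-tabulate; map-tabulate)
open import Data.List.Relation.Binary.Pointwise using (Pointwise; []; _∷_)
open import Data.List.Relation.Unary.All as All using (All; []; _∷_)
open import Data.List.Relation.Unary.AllPairs using ([]; _∷_)
open import Data.List.Relation.Unary.Any using (here; there)
open import Data.List.Relation.Unary.Unique.Propositional using (Unique)
import Data.List.Relation.Unary.Unique.Propositional.Properties as Unique
open import Data.Nat as ℕ using (ℕ; zero; suc; z≤n; s≤s; z<s; >-nonZero)
open import Data.Nat.ListAction using (sum)
import Data.Nat.Properties as ℕ
open import Data.Product using (Σ; _×_; _,_; proj₁; proj₂)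
open import Data.Vec as Vec using (Vec; []; _∷_; lookup; head; tail; here; there)
open import Data.Vec.Functional using (updateAt)
import Data.Vec.Properties as Vec
open import Function using (_∘_; id)
open import Function.Definitions using (Injective)
open import Level using (0ℓ)
open import Relation.Binary using (tri<; tri≈; tri>)
open import Relation.Binary.PropositionalEquality
open import Relation.Nullary using (Dec; does; yes; no)
open import Relation.Nullary.Decidable using (dec-true)

module FieldProperties {t : ℕ} (F : FiniteField t) where

  commutativeRing : CommutativeRing 0ℓ 0ℓ
  commutativeRing = record { isCommutativeRing = FiniteField.isCommutativeRing F }

  open FiniteField F public using (0≢1; inverse)
  open CommutativeRing commutativeRing public
    using ( Carrier; _+_; _*_; -_; _-_; 0#; 1#
          ; +-identityˡ; +-identityʳ; -‿inverseʳ
          ; *-assoc; *-comm; *-identityˡ; *-identityʳ; distribˡ; distribʳ; zeroˡ; zeroʳ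
          ; *-commutativeMonoid; commutativeSemiring )
  open CommutativeRing commutativeRing using (ring; +-group; semiring)
  open import Algebra.Properties.Ring ring public using (-‿distribˡ-*)
  open import Algebra.Properties.Group +-group public
    using ()
    renaming ( x∙y⁻¹≈ε⇒x≈y to x-y≡0⇒x≡y; x≈y⇒x∙y⁻¹≈ε to x≡y⇒x-y≡0
             ; ∙-cancelˡ to +-cancelˡ; ∙-cancelʳ to +-cancelʳ )
  open import Algebra.Definitions.RawSemiring (Semiring.rawSemiring semiring) public using (_^_)
  open import Algebra.Solver.Ring.NaturalCoefficients.Default commutativeSemiring public
    using (solve; _:+_; _:*_; _:=_)

  infix 8 _⁻¹

  -- 0# ⁻¹ is the junk value 0#.
  _⁻¹ : Carrier → Carrier
  x ⁻¹ with x ≟ 0#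
  ... | yes _  = 0#
  ... | no x≢0 = proj₁ (inverse x x≢0)

  x*x⁻¹≡1 : ∀ {x} → x ≢ 0# → x * x ⁻¹ ≡ 1#
  x*x⁻¹≡1 {x} x≢0 with x ≟ 0#
  ... | yes x≡0 = ⊥-elim (x≢0 x≡0)
  ... | no x≢0′ = proj₂ (inverse x x≢0′)

  1≢0 : 1# ≢ 0#
  1≢0 1≡0 = 0≢1 (sym 1≡0)

  x*y≡0⇒y≡0 : ∀ {x y} → x ≢ 0# → x * y ≡ 0# → y ≡ 0#
  x*y≡0⇒y≡0 {x} {y} x≢0 xy≡0 = begin
    y                ≡⟨ sym (*-identityˡ y) ⟩
    1# * y           ≡⟨ cong (_* y) (sym (x*x⁻¹≡1 x≢0)) ⟩
    (x * x ⁻¹) * y   ≡⟨ solve 3 (λ a b c → (a :* b) :* c := b :* (a :* c)) refl x (x ⁻¹) y ⟩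
    x ⁻¹ * (x * y)   ≡⟨ cong (x ⁻¹ *_) xy≡0 ⟩
    x ⁻¹ * 0#        ≡⟨ zeroʳ _ ⟩
    0#               ∎
    where open ≡-Reasoning

  x*y≢0 : ∀ {x y} → x ≢ 0# → y ≢ 0# → x * y ≢ 0#
  x*y≢0 x≢0 y≢0 xy≡0 = y≢0 (x*y≡0⇒y≡0 x≢0 xy≡0)

  x⁻¹≢0 : ∀ {x} → x ≢ 0# → x ⁻¹ ≢ 0#
  x⁻¹≢0 {x} x≢0 x⁻¹≡0 = 1≢0 (begin
    1#          ≡⟨ sym (x*x⁻¹≡1 x≢0) ⟩
    x * x ⁻¹    ≡⟨ cong (x *_) x⁻¹≡0 ⟩
    x * 0#      ≡⟨ zeroʳ x ⟩
    0#          ∎)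
    where open ≡-Reasoning

  ⁻¹-unique : ∀ {x y} → x * y ≡ 1# → x ⁻¹ ≡ y
  ⁻¹-unique {x} {y} xy≡1 = begin
    x ⁻¹              ≡⟨ sym (*-identityʳ _) ⟩
    x ⁻¹ * 1#         ≡⟨ cong (x ⁻¹ *_) (sym xy≡1) ⟩
    x ⁻¹ * (x * y)    ≡⟨ solve 3 (λ a b c → b :* (a :* c) := (a :* b) :* c) refl x (x ⁻¹) y ⟩
    (x * x ⁻¹) * y    ≡⟨ cong (_* y) (x*x⁻¹≡1 x≢0) ⟩
    1# * y            ≡⟨ *-identityˡ y ⟩
    y                 ∎
    where
    open ≡-Reasoning
    x≢0 : x ≢ 0#
    x≢0 x≡0 = 0≢1 (trans (sym (zeroˡ y)) (trans (cong (_* y) (sym x≡0)) xy≡1))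

  ⁻¹-distrib-* : ∀ {x y} → x ≢ 0# → y ≢ 0# → (x * y) ⁻¹ ≡ x ⁻¹ * y ⁻¹
  ⁻¹-distrib-* {x} {y} x≢0 y≢0 = ⁻¹-unique (begin
    (x * y) * (x ⁻¹ * y ⁻¹)   ≡⟨ solve 4 (λ a b c d → (a :* b) :* (c :* d) := (a :* c) :* (b :* d)) refl x y (x ⁻¹) (y ⁻¹) ⟩
    (x * x ⁻¹) * (y * y ⁻¹)   ≡⟨ cong₂ _*_ (x*x⁻¹≡1 x≢0) (x*x⁻¹≡1 y≢0) ⟩
    1# * 1#                   ≡⟨ *-identityˡ 1# ⟩
    1#                        ∎)
    where open ≡-Reasoning

  x*[y*[x⁻¹*z]]≡y*z : ∀ {x} y z → x ≢ 0# → x * (y * (x ⁻¹ * z)) ≡ y * z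
  x*[y*[x⁻¹*z]]≡y*z {x} y z x≢0 = begin
    x * (y * (x ⁻¹ * z))    ≡⟨ solve 4 (λ a b c d → a :* (b :* (c :* d)) := b :* ((a :* c) :* d)) refl x y (x ⁻¹) z ⟩
    y * ((x * x ⁻¹) * z)    ≡⟨ cong (λ w → y * (w * z)) (x*x⁻¹≡1 x≢0) ⟩
    y * (1# * z)            ≡⟨ cong (y *_) (*-identityˡ z) ⟩
    y * z                   ∎
    where open ≡-Reasoning

  1⁻¹≡1 : 1# ⁻¹ ≡ 1#
  1⁻¹≡1 = ⁻¹-unique (*-identityˡ 1#)

  x≢y⇒x-y≢0 : ∀ {x y} → x ≢ y → x - y ≢ 0#
  x≢y⇒x-y≢0 {x} {y} x≢y x-y≡0 = x≢y (x-y≡0⇒x≡y x y x-y≡0)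

  -x≡-1*x : ∀ x → - x ≡ (- 1#) * x
  -x≡-1*x x = trans (cong -_ (sym (*-identityˡ x))) (-‿distribˡ-* 1# x)

  *-splitʳ : ∀ a c x → a * x ≡ c * x + (a - c) * x
  *-splitʳ a c x = sym (begin
    c * x + (a - c) * x            ≡⟨ cong (c * x +_) (distribʳ x a (- c)) ⟩
    c * x + (a * x + (- c) * x)    ≡⟨ cong (λ y → c * x + (a * x + y)) (sym (-‿distribˡ-* c x)) ⟩
    c * x + (a * x - c * x)        ≡⟨ solve 3 (λ u v w → u :+ (v :+ w) := v :+ (u :+ w)) refl (c * x) (a * x) (- (c * x)) ⟩
    a * x + (c * x - c * x)        ≡⟨ cong (a * x +_) (-‿inverseʳ (c * x)) ⟩
    a * x + 0#                     ≡⟨ +-identityʳ (a * x) ⟩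
    a * x                          ∎)
    where open ≡-Reasoning

module ListSums {t : ℕ} (F : FiniteField t) where

  open FieldProperties F

  ∑ : {A : Set} → List A → (A → Carrier) → Carrier
  ∑ []       g = 0#
  ∑ (x ∷ xs) g = g x + ∑ xs g

  ∏ : {A : Set} → List A → (A → Carrier) → Carrier
  ∏ []       g = 1#
  ∏ (x ∷ xs) g = g x * ∏ xs g

  module _ {A : Set} where

    ∑-cong : ∀ xs {g h : A → Carrier} → (∀ {x} → x ∈ xs → g x ≡ h x) → ∑ xs g ≡ ∑ xs h
    ∑-cong []       g≗h = refl
    ∑-cong (x ∷ xs) g≗h = cong₂ _+_ (g≗h (here refl)) (∑-cong xs (g≗h ∘ there))

    ∏-cong : ∀ xs {g h : A → Carrier} → (∀ {x} → x ∈ xs → g x ≡ h x) → ∏ xs g ≡ ∏ xs h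
    ∏-cong []       g≗h = refl
    ∏-cong (x ∷ xs) g≗h = cong₂ _*_ (g≗h (here refl)) (∏-cong xs (g≗h ∘ there))

    ∑-distrib-+ : ∀ xs (g h : A → Carrier) → ∑ xs (λ x → g x + h x) ≡ ∑ xs g + ∑ xs h
    ∑-distrib-+ []       g h = sym (+-identityˡ 0#)
    ∑-distrib-+ (x ∷ xs) g h = begin
      (g x + h x) + ∑ xs (λ y → g y + h y)    ≡⟨ cong ((g x + h x) +_) (∑-distrib-+ xs g h) ⟩
      (g x + h x) + (∑ xs g + ∑ xs h)
        ≡⟨ solve 4 (λ a b c d → (a :+ b) :+ (c :+ d) := (a :+ c) :+ (b :+ d)) refl (g x) (h x) (∑ xs g) (∑ xs h) ⟩
      (g x + ∑ xs g) + (h x + ∑ xs h)         ∎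
      where open ≡-Reasoning

    *-distribˡ-∑ : ∀ c xs (g : A → Carrier) → c * ∑ xs g ≡ ∑ xs (λ x → c * g x)
    *-distribˡ-∑ c []       g = zeroʳ c
    *-distribˡ-∑ c (x ∷ xs) g = trans (distribˡ c (g x) (∑ xs g)) (cong (c * g x +_) (*-distribˡ-∑ c xs g))

    *-distribʳ-∑ : ∀ c xs (g : A → Carrier) → ∑ xs g * c ≡ ∑ xs (λ x → g x * c)
    *-distribʳ-∑ c xs g = begin
      ∑ xs g * c                ≡⟨ *-comm (∑ xs g) c ⟩
      c * ∑ xs g                ≡⟨ *-distribˡ-∑ c xs g ⟩
      ∑ xs (λ x → c * g x)      ≡⟨ ∑-cong xs (λ {x} _ → *-comm c (g x)) ⟩
      ∑ xs (λ x → g x * c)      ∎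
      where open ≡-Reasoning

    ∑-zero : ∀ (xs : List A) → ∑ xs (λ _ → 0#) ≡ 0#
    ∑-zero []       = refl
    ∑-zero (x ∷ xs) = trans (cong (0# +_) (∑-zero xs)) (+-identityˡ 0#)

    ∑-swap : ∀ x y xs (g : A → Carrier) → ∑ (x ∷ y ∷ xs) g ≡ ∑ (y ∷ x ∷ xs) g
    ∑-swap x y xs g = solve 3 (λ a b c → a :+ (b :+ c) := b :+ (a :+ c)) refl (g x) (g y) (∑ xs g)

    ∏-swap : ∀ x y xs (g : A → Carrier) → ∏ (x ∷ y ∷ xs) g ≡ ∏ (y ∷ x ∷ xs) g
    ∏-swap x y xs g = solve 3 (λ a b c → a :* (b :* c) := b :* (a :* c)) refl (g x) (g y) (∏ xs g)

    ∑≢0⇒∃≢0 : ∀ xs (g : A → Carrier) → ∑ xs g ≢ 0# → Σ A λ x → x ∈ xs × g x ≢ 0#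
    ∑≢0⇒∃≢0 []       g ∑≢0 = ⊥-elim (∑≢0 refl)
    ∑≢0⇒∃≢0 (x ∷ xs) g ∑≢0 with g x ≟ 0#
    ... | no gx≢0 = x , here refl , gx≢0
    ... | yes gx≡0 =
      let y , y∈xs , gy≢0 = ∑≢0⇒∃≢0 xs g (λ ∑xs≡0 → ∑≢0 (trans (cong₂ _+_ gx≡0 ∑xs≡0) (+-identityˡ 0#)))
      in  y , there y∈xs , gy≢0

    ∏-zero : ∀ {xs} (g : A → Carrier) {x} → x ∈ xs → g x ≡ 0# → ∏ xs g ≡ 0#
    ∏-zero {y ∷ xs} g (here refl) gx≡0 = trans (cong (_* ∏ xs g) gx≡0) (zeroˡ _)
    ∏-zero {y ∷ xs} g (there x∈xs) gx≡0 = trans (cong (g y *_) (∏-zero g x∈xs gx≡0)) (zeroʳ _)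

    ∏≢0 : ∀ xs (g : A → Carrier) → (∀ {x} → x ∈ xs → g x ≢ 0#) → ∏ xs g ≢ 0#
    ∏≢0 []       g g≢0 = 1≢0
    ∏≢0 (x ∷ xs) g g≢0 = x*y≢0 (g≢0 (here refl)) (∏≢0 xs g (g≢0 ∘ there))

    ∏≢0⇒≢0 : ∀ {xs} (g : A → Carrier) → ∏ xs g ≢ 0# → ∀ {x} → x ∈ xs → g x ≢ 0#
    ∏≢0⇒≢0 g ∏≢0 x∈xs gx≡0 = ∏≢0 (∏-zero g x∈xs gx≡0)

    ∑-supported-at : ∀ {xs} (g : A → Carrier) {c} → Unique xs → c ∈ xs →
                     (∀ {x} → x ∈ xs → x ≢ c → g x ≡ 0#) → ∑ xs g ≡ g c
    ∑-supported-at {x ∷ xs} g (x∉xs ∷ _) (here refl) g≡0 = begin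
      g x + ∑ xs g          ≡⟨ cong (g x +_) (∑-cong xs (λ y∈xs → g≡0 (there y∈xs) (All.lookup x∉xs y∈xs ∘ sym))) ⟩
      g x + ∑ xs (λ _ → 0#) ≡⟨ cong (g x +_) (∑-zero xs) ⟩
      g x + 0#              ≡⟨ +-identityʳ (g x) ⟩
      g x                   ∎
      where open ≡-Reasoning
    ∑-supported-at {x ∷ xs} g {c} (x∉xs ∷ uxs) (there c∈xs) g≡0 = begin
      g x + ∑ xs g          ≡⟨ cong (_+ ∑ xs g) (g≡0 (here refl) (All.lookup x∉xs c∈xs)) ⟩
      0# + ∑ xs g           ≡⟨ +-identityˡ (∑ xs g) ⟩
      ∑ xs g                ≡⟨ ∑-supported-at g uxs c∈xs (g≡0 ∘ there) ⟩
      g c                   ∎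
      where open ≡-Reasoning

module Interpolation {t : ℕ} (F : FiniteField t) where

  open FieldProperties F
  open ListSums F

  lagrangeDenominator : List Carrier → Carrier → Carrier
  lagrangeDenominator A a = ∏ A (λ b → if does (b ≟ a) then 1# else a - b)

  lagrangeWeight : List Carrier → Carrier → Carrier
  lagrangeWeight A a = lagrangeDenominator A a ⁻¹

  dividedDifference : ℕ → List Carrier → Carrier
  dividedDifference m A = ∑ A (λ a → a ^ m * lagrangeWeight A a)

  lagrangeDenominator≢0 : ∀ A a → lagrangeDenominator A a ≢ 0#
  lagrangeDenominator≢0 A a = ∏≢0 A _ factor≢0
    where
    factor≢0 : ∀ {b} → b ∈ A → (if does (b ≟ a) then 1# else a - b) ≢ 0#
    factor≢0 {b} _ with b ≟ a
    ... | yes _   = 1≢0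
    ... | no b≢a  = x≢y⇒x-y≢0 (b≢a ∘ sym)

  lagrangeWeight-∷ : ∀ {c a} A → c ≢ a → lagrangeWeight (c ∷ A) a ≡ (a - c) ⁻¹ * lagrangeWeight A a
  lagrangeWeight-∷ {c} {a} A c≢a with c ≟ a
  ... | yes c≡a = ⊥-elim (c≢a c≡a)
  ... | no _    = ⁻¹-distrib-* (x≢y⇒x-y≢0 (c≢a ∘ sym)) (lagrangeDenominator≢0 A a)

  dividedDifference-∷ : ∀ m {c} A → All (c ≢_) A →
    dividedDifference (suc m) (c ∷ A) ≡ c * dividedDifference m (c ∷ A) + dividedDifference m A
  dividedDifference-∷ m {c} A c∉A = begin
    (c * c ^ m) * w c + ∑ A (λ a → (a * a ^ m) * w a)
      ≡⟨ cong ((c * c ^ m) * w c +_) (∑-cong A shift) ⟩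
    (c * c ^ m) * w c + ∑ A (λ a → c * (a ^ m * w a) + a ^ m * lagrangeWeight A a)
      ≡⟨ cong ((c * c ^ m) * w c +_) (∑-distrib-+ A _ _) ⟩
    (c * c ^ m) * w c + (∑ A (λ a → c * (a ^ m * w a)) + dividedDifference m A)
      ≡⟨ cong (λ y → (c * c ^ m) * w c + (y + dividedDifference m A)) (sym (*-distribˡ-∑ c A _)) ⟩
    (c * c ^ m) * w c + (c * ∑ A (λ a → a ^ m * w a) + dividedDifference m A)
      ≡⟨ solve 5 (λ c p w s d → (c :* p) :* w :+ (c :* s :+ d) := c :* (p :* w :+ s) :+ d) refl
               c (c ^ m) (w c) (∑ A (λ a → a ^ m * w a)) (dividedDifference m A) ⟩
    c * dividedDifference m (c ∷ A) + dividedDifference m A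
      ∎
    where
    open ≡-Reasoning
    w : Carrier → Carrier
    w = lagrangeWeight (c ∷ A)
    shift : ∀ {a} → a ∈ A → (a * a ^ m) * w a ≡ c * (a ^ m * w a) + a ^ m * lagrangeWeight A a
    shift {a} a∈A = begin
      (a * a ^ m) * w a                                ≡⟨ *-assoc a (a ^ m) (w a) ⟩
      a * (a ^ m * w a)                                ≡⟨ *-splitʳ a c _ ⟩
      c * (a ^ m * w a) + (a - c) * (a ^ m * w a)      ≡⟨ cong (λ y → c * (a ^ m * w a) + (a - c) * (a ^ m * y)) (lagrangeWeight-∷ A c≢a) ⟩
      c * (a ^ m * w a) + (a - c) * (a ^ m * ((a - c) ⁻¹ * lagrangeWeight A a))
        ≡⟨ cong (c * (a ^ m * w a) +_) (x*[y*[x⁻¹*z]]≡y*z _ _ (x≢y⇒x-y≢0 (c≢a ∘ sym))) ⟩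
      c * (a ^ m * w a) + a ^ m * lagrangeWeight A a   ∎
      where
      c≢a : c ≢ a
      c≢a = All.lookup c∉A a∈A

  dividedDifference-swap : ∀ m c c′ A → dividedDifference m (c ∷ c′ ∷ A) ≡ dividedDifference m (c′ ∷ c ∷ A)
  dividedDifference-swap m c c′ A = begin
    ∑ (c ∷ c′ ∷ A) (λ a → a ^ m * lagrangeWeight (c ∷ c′ ∷ A) a)
      ≡⟨ ∑-cong (c ∷ c′ ∷ A) (λ {a} _ → cong (λ y → a ^ m * y ⁻¹) (∏-swap c c′ A _)) ⟩
    ∑ (c ∷ c′ ∷ A) (λ a → a ^ m * lagrangeWeight (c′ ∷ c ∷ A) a)
      ≡⟨ ∑-swap c c′ A _ ⟩
    ∑ (c′ ∷ c ∷ A) (λ a → a ^ m * lagrangeWeight (c′ ∷ c ∷ A) a)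
      ∎
    where open ≡-Reasoning

  dividedDifference-[_] : ∀ c → dividedDifference 0 (c ∷ []) ≡ 1#
  dividedDifference-[ c ] with c ≟ c
  ... | no c≢c = ⊥-elim (c≢c refl)
  ... | yes _  = trans (+-identityʳ _) (trans (*-identityˡ _) (trans (cong _⁻¹ (*-identityˡ 1#)) 1⁻¹≡1))

  DividedDifferencesOfPowers : ℕ → List Carrier → Set
  DividedDifferencesOfPowers k A =
    (∀ m → m ℕ.< k → dividedDifference m A ≡ 0#) × dividedDifference k A ≡ 1#

  dividedDifferencesOfPowers-∷ : ∀ k {c} A → All (c ≢_) A → dividedDifference 0 (c ∷ A) ≡ 0# →
    DividedDifferencesOfPowers k A → DividedDifferencesOfPowers (suc k) (c ∷ A)
  dividedDifferencesOfPowers-∷ k {c} A c∉A Δ₀≡0 (low , top) = vanish , top′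
    where
    open ≡-Reasoning
    Δ = dividedDifference

    vanish : ∀ m → m ℕ.< suc k → Δ m (c ∷ A) ≡ 0#
    vanish zero    _         = Δ₀≡0
    vanish (suc m) (s≤s m<k) = begin
      Δ (suc m) (c ∷ A)           ≡⟨ dividedDifference-∷ m A c∉A ⟩
      c * Δ m (c ∷ A) + Δ m A     ≡⟨ cong₂ (λ y z → c * y + z) (vanish m (ℕ.m≤n⇒m≤1+n m<k)) (low m m<k) ⟩
      c * 0# + 0#                 ≡⟨ +-identityʳ _ ⟩
      c * 0#                      ≡⟨ zeroʳ c ⟩
      0#                          ∎

    top′ : Δ (suc k) (c ∷ A) ≡ 1#
    top′ = begin
      Δ (suc k) (c ∷ A)           ≡⟨ dividedDifference-∷ k A c∉A ⟩
      c * Δ k (c ∷ A) + Δ k A     ≡⟨ cong₂ (λ y z → c * y + z) (vanish k ℕ.≤-refl) top ⟩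
      c * 0# + 1#                 ≡⟨ cong (_+ 1#) (zeroʳ c) ⟩
      0# + 1#                     ≡⟨ +-identityˡ 1# ⟩
      1#                          ∎

  dividedDifferencesOfPowers : ∀ k A → Unique A → length A ≡ suc k → DividedDifferencesOfPowers k A
  dividedDifferencesOfPowers zero (c ∷ []) _ _ = (λ _ ()) , dividedDifference-[ c ]
  dividedDifferencesOfPowers (suc k) (c ∷ c′ ∷ A) ((c≢c′ ∷ c∉A) ∷ c′∉A ∷ uA) |D|≡ =
    dividedDifferencesOfPowers-∷ k (c′ ∷ A) (c≢c′ ∷ c∉A) Δ₀≡0 IH′
    where
    open ≡-Reasoning
    D = c ∷ c′ ∷ A
    Δ = dividedDifference

    IH′ : DividedDifferencesOfPowers k (c′ ∷ A)
    IH′ = dividedDifferencesOfPowers k (c′ ∷ A) (c′∉A ∷ uA) (ℕ.suc-injective |D|≡)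

    IH : DividedDifferencesOfPowers k (c ∷ A)
    IH = dividedDifferencesOfPowers k (c ∷ A) (c∉A ∷ uA) (ℕ.suc-injective |D|≡)

    Δ₀-agree : ∀ j B B′ → DividedDifferencesOfPowers j B → DividedDifferencesOfPowers j B′ → Δ 0 B ≡ Δ 0 B′
    Δ₀-agree zero    _ _ (_ , top) (_ , top′) = trans top (sym top′)
    Δ₀-agree (suc _) _ _ (low , _) (low′ , _) = trans (low 0 (s≤s z≤n)) (sym (low′ 0 (s≤s z≤n)))

    -- Expanding Δ 1 D along c and along c′ gives c · Δ 0 D = c′ · Δ 0 D.
    c*Δ₀≡c′*Δ₀ : c * Δ 0 D ≡ c′ * Δ 0 D
    c*Δ₀≡c′*Δ₀ = +-cancelʳ (Δ 0 (c′ ∷ A)) _ _ (begin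
      c * Δ 0 D + Δ 0 (c′ ∷ A)              ≡⟨ sym (dividedDifference-∷ 0 (c′ ∷ A) (c≢c′ ∷ c∉A)) ⟩
      Δ 1 D                                 ≡⟨ dividedDifference-swap 1 c c′ A ⟩
      Δ 1 (c′ ∷ c ∷ A)                      ≡⟨ dividedDifference-∷ 0 (c ∷ A) ((c≢c′ ∘ sym) ∷ c′∉A) ⟩
      c′ * Δ 0 (c′ ∷ c ∷ A) + Δ 0 (c ∷ A)   ≡⟨ cong₂ (λ y z → c′ * y + z) (sym (dividedDifference-swap 0 c c′ A))
                                                                          (Δ₀-agree k (c ∷ A) (c′ ∷ A) IH IH′) ⟩
      c′ * Δ 0 D + Δ 0 (c′ ∷ A)             ∎)

    Δ₀≡0 : Δ 0 D ≡ 0#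
    Δ₀≡0 = x*y≡0⇒y≡0 (x≢y⇒x-y≢0 c≢c′) (+-cancelˡ (c′ * Δ 0 D) _ _ (begin
      c′ * Δ 0 D + (c - c′) * Δ 0 D    ≡⟨ sym (*-splitʳ c c′ (Δ 0 D)) ⟩
      c * Δ 0 D                        ≡⟨ c*Δ₀≡c′*Δ₀ ⟩
      c′ * Δ 0 D                       ≡⟨ sym (+-identityʳ _) ⟩
      c′ * Δ 0 D + 0#                  ∎))

Monomial : ℕ → Set
Monomial n = Fin n → ℕ

open import Algebra.Properties.CommutativeMonoid.Sum ℕ.+-0-commutativeMonoid
  using () renaming (sum to degree; sum-cong-≗ to degree-cong; sum-replicate-zero to degree-zero)

degree-updateAt : ∀ {n} (u : Fin n) e → degree (updateAt e u suc) ≡ suc (degree e)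
degree-updateAt zero    e = refl
degree-updateAt (suc u) e = trans (cong (e zero ℕ.+_) (degree-updateAt u (e ∘ suc))) (ℕ.+-suc _ _)

degree-mono : ∀ {n} {k e : Monomial n} → (∀ v → k v ℕ.≤ e v) → degree k ℕ.≤ degree e
degree-mono {zero}  _   = z≤n
degree-mono {suc n} k≤e = ℕ.+-mono-≤ (k≤e zero) (degree-mono (k≤e ∘ suc))

degree-squeeze : ∀ {n} {k e : Monomial n} → (∀ v → k v ℕ.≤ e v) → degree e ℕ.≤ degree k → ∀ v → e v ≡ k v
degree-squeeze {suc n} {k} {e} k≤e e≤k zero =
  ℕ.≤-antisym (ℕ.+-cancelʳ-≤ (degree (e ∘ suc)) (e zero) (k zero)
                (ℕ.≤-trans e≤k (ℕ.+-mono-≤ (ℕ.≤-refl {k zero}) (degree-mono (k≤e ∘ suc)))))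
              (k≤e zero)
degree-squeeze {suc n} {k} {e} k≤e e≤k (suc v) =
  degree-squeeze (k≤e ∘ suc)
    (ℕ.+-cancelˡ-≤ (e zero) (degree (e ∘ suc)) (degree (k ∘ suc))
      (ℕ.≤-trans e≤k (ℕ.+-mono-≤ (k≤e zero) (ℕ.≤-refl {degree (k ∘ suc)}))))
    v

sumF≡degree : ∀ {n} (f : Fin n → ℕ) → sumF f ≡ degree f
sumF≡degree {n} f = trans (cong sum (map-tabulate id f)) (sum-tabulate f)
  where
  sum-tabulate : ∀ {m} (g : Fin m → ℕ) → sum (tabulate g) ≡ degree g
  sum-tabulate {zero}  g = refl
  sum-tabulate {suc m} g = cong (g zero ℕ.+_) (sum-tabulate (g ∘ suc))

degree-suc : ∀ {n} {f k : Monomial n} → (∀ v → f v ≡ suc (k v)) → degree f ≡ n ℕ.+ degree k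
degree-suc {zero}          _  = refl
degree-suc {suc n} {f} {k} f≡ = begin
  f zero ℕ.+ degree (f ∘ suc)               ≡⟨ cong₂ ℕ._+_ (f≡ zero) (degree-suc (f≡ ∘ suc)) ⟩
  suc (k zero ℕ.+ (n ℕ.+ degree (k ∘ suc))) ≡⟨ cong suc (x∙yz≈y∙xz (k zero) n _) ⟩
  suc (n ℕ.+ degree k)                      ∎
  where
  open ≡-Reasoning
  open import Algebra.Properties.CommutativeSemigroup ℕ.+-commutativeSemigroup using (x∙yz≈y∙xz)

sumF≡n+m⇒degree≡m : ∀ {n m} {f k : Monomial n} → (∀ v → f v ≡ suc (k v)) → sumF f ≡ n ℕ.+ m → degree k ≡ m
sumF≡n+m⇒degree≡m {n} {m} {f} {k} f≡ ∑f≡ = ℕ.+-cancelˡ-≡ n (degree k) m (begin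
  n ℕ.+ degree k    ≡⟨ sym (degree-suc f≡) ⟩
  degree f          ≡⟨ sym (sumF≡degree f) ⟩
  sumF f            ≡⟨ ∑f≡ ⟩
  n ℕ.+ m           ∎)
  where open ≡-Reasoning

module GridSums {t : ℕ} (F : FiniteField t) where

  open FieldProperties F
  open ListSums F
  open Interpolation F
  open import Algebra.Properties.CommutativeMonoid.Sum *-commutativeMonoid public
    using () renaming (sum to product; sum-cong-≗ to product-cong)

  product-zero : ∀ {n} (g : Fin n → Carrier) v → g v ≡ 0# → product g ≡ 0#
  product-zero g zero    g₀≡0 = trans (cong (_* product (g ∘ suc)) g₀≡0) (zeroˡ _)
  product-zero g (suc v) gᵥ≡0 = trans (cong (g zero *_) (product-zero (g ∘ suc) v gᵥ≡0)) (zeroʳ _)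

  OnGrid : ∀ {n} → (Fin n → List Carrier) → Vec Carrier n → Set
  OnGrid A x = ∀ v → lookup x v ∈ A v

  _∷ᵍ_ : ∀ {n} {A : Fin (suc n) → List Carrier} {a x} → a ∈ A zero → OnGrid (A ∘ suc) x → OnGrid A (a ∷ x)
  (a∈A ∷ᵍ x∈A) zero    = a∈A
  (a∈A ∷ᵍ x∈A) (suc v) = x∈A v

  gridSum : ∀ {n} → (Fin n → List Carrier) → (Vec Carrier n → Carrier) → Carrier
  gridSum {zero}  A g = g []
  gridSum {suc n} A g = ∑ (A zero) (λ a → gridSum (A ∘ suc) (g ∘ (a ∷_)))

  gridSum-cong : ∀ {n} (A : Fin n → List Carrier) {g h} → (∀ {x} → OnGrid A x → g x ≡ h x) → gridSum A g ≡ gridSum A h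
  gridSum-cong {zero}  A g≗h = g≗h (λ ())
  gridSum-cong {suc n} A g≗h = ∑-cong (A zero) (λ a∈A → gridSum-cong (A ∘ suc) (λ x∈A → g≗h (a∈A ∷ᵍ x∈A)))

  gridSum-distrib-+ : ∀ {n} (A : Fin n → List Carrier) g h → gridSum A (λ x → g x + h x) ≡ gridSum A g + gridSum A h
  gridSum-distrib-+ {zero}  A g h = refl
  gridSum-distrib-+ {suc n} A g h =
    trans (∑-cong (A zero) (λ {a} _ → gridSum-distrib-+ (A ∘ suc) (g ∘ (a ∷_)) (h ∘ (a ∷_))))
          (∑-distrib-+ (A zero) _ _)

  *-distribˡ-gridSum : ∀ {n} c (A : Fin n → List Carrier) g → c * gridSum A g ≡ gridSum A (λ x → c * g x)
  *-distribˡ-gridSum {zero}  c A g = refl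
  *-distribˡ-gridSum {suc n} c A g =
    trans (*-distribˡ-∑ c (A zero) _) (∑-cong (A zero) (λ {a} _ → *-distribˡ-gridSum c (A ∘ suc) (g ∘ (a ∷_))))

  gridSum-zero : ∀ {n} (A : Fin n → List Carrier) → gridSum A (λ _ → 0#) ≡ 0#
  gridSum-zero {zero}  A = refl
  gridSum-zero {suc n} A = trans (∑-cong (A zero) (λ _ → gridSum-zero (A ∘ suc))) (∑-zero (A zero))

  gridSum-product : ∀ {n} (A : Fin n → List Carrier) (φ : Fin n → Carrier → Carrier) →
    gridSum A (λ x → product (λ v → φ v (lookup x v))) ≡ product (λ v → ∑ (A v) (φ v))
  gridSum-product {zero}  A φ = refl
  gridSum-product {suc n} A φ = begin
    ∑ (A zero) (λ a → gridSum (A ∘ suc) (λ x → φ zero a * product (λ v → φ (suc v) (lookup x v))))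
      ≡⟨ ∑-cong (A zero) (λ {a} _ → sym (*-distribˡ-gridSum (φ zero a) (A ∘ suc) _)) ⟩
    ∑ (A zero) (λ a → φ zero a * gridSum (A ∘ suc) (λ x → product (λ v → φ (suc v) (lookup x v))))
      ≡⟨ ∑-cong (A zero) (λ {a} _ → cong (φ zero a *_) (gridSum-product (A ∘ suc) (φ ∘ suc))) ⟩
    ∑ (A zero) (λ a → φ zero a * product (λ v → ∑ (A (suc v)) (φ (suc v))))
      ≡⟨ sym (*-distribʳ-∑ _ (A zero) (φ zero)) ⟩
    ∑ (A zero) (φ zero) * product (λ v → ∑ (A (suc v)) (φ (suc v)))
      ∎
    where open ≡-Reasoning

  gridSum≢0⇒∃≢0 : ∀ {n} (A : Fin n → List Carrier) g → gridSum A g ≢ 0# → Σ (Vec Carrier n) λ x → OnGrid A x × g x ≢ 0#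
  gridSum≢0⇒∃≢0 {zero}  A g ≢0 = [] , (λ ()) , ≢0
  gridSum≢0⇒∃≢0 {suc n} A g ≢0 =
    let a , a∈A , ≢0′ = ∑≢0⇒∃≢0 (A zero) _ ≢0
        x , x∈A , gax≢0 = gridSum≢0⇒∃≢0 (A ∘ suc) (g ∘ (a ∷_)) ≢0′
    in  a ∷ x , a∈A ∷ᵍ x∈A , gax≢0

  gridSum-supported-at : ∀ {n} (A : Fin n → List Carrier) g {c} → (∀ v → Unique (A v)) → OnGrid A c →
    (∀ {x} → OnGrid A x → x ≢ c → g x ≡ 0#) → gridSum A g ≡ g c
  gridSum-supported-at {zero}  A g {[]}    _ _ _ = refl
  gridSum-supported-at {suc n} A g {c ∷ cs} uA c∈A g≡0 = begin
    ∑ (A zero) (λ a → gridSum (A ∘ suc) (g ∘ (a ∷_)))    ≡⟨ ∑-supported-at _ (uA zero) (c∈A zero) off-c ⟩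
    gridSum (A ∘ suc) (g ∘ (c ∷_))                      ≡⟨ gridSum-supported-at (A ∘ suc) (g ∘ (c ∷_)) (uA ∘ suc) (c∈A ∘ suc)
                                                             (λ x∈A x≢cs → g≡0 (c∈A zero ∷ᵍ x∈A) (x≢cs ∘ cong tail)) ⟩
    g (c ∷ cs)                                          ∎
    where
    open ≡-Reasoning
    off-c : ∀ {a} → a ∈ A zero → a ≢ c → gridSum (A ∘ suc) (g ∘ (a ∷_)) ≡ 0#
    off-c a∈A a≢c = trans (gridSum-cong (A ∘ suc) (λ x∈A → g≡0 (a∈A ∷ᵍ x∈A) (a≢c ∘ cong head))) (gridSum-zero (A ∘ suc))

  gridWeight : ∀ {n} → (Fin n → List Carrier) → Vec Carrier n → Carrier
  gridWeight A x = product (λ v → lagrangeWeight (A v) (lookup x v))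

  gridWeight≢0 : ∀ {n} (A : Fin n → List Carrier) x → gridWeight A x ≢ 0#
  gridWeight≢0 {zero}  A x = 1≢0
  gridWeight≢0 {suc n} A (a ∷ x) = x*y≢0 (x⁻¹≢0 (lagrangeDenominator≢0 (A zero) a)) (gridWeight≢0 (A ∘ suc) x)

  weightedSum : ∀ {n} → (Fin n → List Carrier) → (Vec Carrier n → Carrier) → Carrier
  weightedSum A g = gridSum A (λ x → g x * gridWeight A x)

module Polynomials {t : ℕ} (F : FiniteField t) where

  open FieldProperties F
  open ListSums F
  open Interpolation F
  open GridSums F
  open import Algebra.Properties.CommutativeMonoid.Sum *-commutativeMonoid
    using () renaming (∑-distrib-+ to product-distrib-*; sum-replicate-zero to product-ones)

  Term : ℕ → Set
  Term n = Carrier × Monomial n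

  Polynomial : ℕ → Set
  Polynomial n = List (Term n)

  monomial : ∀ {n} → Monomial n → Vec Carrier n → Carrier
  monomial e x = product (λ v → lookup x v ^ e v)

  evalTerm : ∀ {n} → Term n → Vec Carrier n → Carrier
  evalTerm (c , e) x = c * monomial e x

  eval : ∀ {n} → Polynomial n → Vec Carrier n → Carrier
  eval p x = ∑ p (λ τ → evalTerm τ x)

  gridDifference : ∀ {n} → (Fin n → List Carrier) → Monomial n → Carrier
  gridDifference A e = product (λ v → dividedDifference (e v) (A v))

  gridDifference-cong : ∀ {n} (A : Fin n → List Carrier) {e e′} → (∀ v → e v ≡ e′ v) → gridDifference A e ≡ gridDifference A e′
  gridDifference-cong A e≡e′ = product-cong (λ v → cong (λ j → dividedDifference j (A v)) (e≡e′ v))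

  termWeightedSum : ∀ {n} → (Fin n → List Carrier) → Term n → Carrier
  termWeightedSum A (c , e) = c * gridDifference A e

  weightedSum-monomial : ∀ {n} (A : Fin n → List Carrier) e → weightedSum A (monomial e) ≡ gridDifference A e
  weightedSum-monomial A e =
    trans (gridSum-cong A (λ {x} _ → sym (product-distrib-* (λ v → lookup x v ^ e v) (λ v → lagrangeWeight (A v) (lookup x v)))))
          (gridSum-product A (λ v a → a ^ e v * lagrangeWeight (A v) a))

  weightedSum-eval : ∀ {n} (A : Fin n → List Carrier) p → weightedSum A (eval p) ≡ ∑ p (termWeightedSum A)
  weightedSum-eval A [] = trans (gridSum-cong A (λ _ → zeroˡ _)) (gridSum-zero A)
  weightedSum-eval A ((c , e) ∷ p) = begin
    gridSum A (λ x → (c * monomial e x + eval p x) * gridWeight A x)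
      ≡⟨ gridSum-cong A (λ {x} _ → solve 4 (λ c m e w → (c :* m :+ e) :* w := c :* (m :* w) :+ e :* w)
                                           refl c (monomial e x) (eval p x) (gridWeight A x)) ⟩
    gridSum A (λ x → c * (monomial e x * gridWeight A x) + eval p x * gridWeight A x)
      ≡⟨ gridSum-distrib-+ A _ _ ⟩
    gridSum A (λ x → c * (monomial e x * gridWeight A x)) + weightedSum A (eval p)
      ≡⟨ cong₂ _+_ (trans (sym (*-distribˡ-gridSum c A _)) (cong (c *_) (weightedSum-monomial A e))) (weightedSum-eval A p) ⟩
    termWeightedSum A (c , e) + ∑ p (termWeightedSum A)
      ∎
    where open ≡-Reasoning

  monomial-updateAt : ∀ {n} (u : Fin n) e x → monomial (updateAt e u suc) x ≡ lookup x u * monomial e x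
  monomial-updateAt zero    e (a ∷ x) = *-assoc a _ _
  monomial-updateAt (suc u) e (a ∷ x) =
    trans (cong (a ^ e zero *_) (monomial-updateAt u (e ∘ suc) x))
          (solve 3 (λ p y m → p :* (y :* m) := y :* (p :* m)) refl (a ^ e zero) (lookup x u) (monomial (e ∘ suc) x))

  timesLinear : ∀ {n} → Fin n → Fin n → Carrier → Polynomial n → Polynomial n
  timesLinear u v d []            = []
  timesLinear u v d ((c , e) ∷ p) =
    (c , updateAt e u suc) ∷ ((- 1#) * c , updateAt e v suc) ∷ ((- 1#) * (c * d) , e) ∷ timesLinear u v d p

  eval-timesLinear : ∀ {n} u v d (p : Polynomial n) x →
    eval (timesLinear u v d p) x ≡ eval p x * ((lookup x u - lookup x v) - d)
  eval-timesLinear u v d []            x = sym (zeroˡ _)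
  eval-timesLinear u v d ((c , e) ∷ p) x = begin
    c * monomial (updateAt e u suc) x + ((- 1#) * c * monomial (updateAt e v suc) x
      + ((- 1#) * (c * d) * M + eval (timesLinear u v d p) x))
      ≡⟨ cong₂ (λ y z → c * y + ((- 1#) * c * z + ((- 1#) * (c * d) * M + eval (timesLinear u v d p) x)))
               (monomial-updateAt u e x) (monomial-updateAt v e x) ⟩
    c * (xᵤ * M) + ((- 1#) * c * (xᵥ * M) + ((- 1#) * (c * d) * M + eval (timesLinear u v d p) x))
      ≡⟨ cong (λ y → c * (xᵤ * M) + ((- 1#) * c * (xᵥ * M) + ((- 1#) * (c * d) * M + y))) (eval-timesLinear u v d p x) ⟩
    c * (xᵤ * M) + ((- 1#) * c * (xᵥ * M) + ((- 1#) * (c * d) * M + eval p x * ((xᵤ - xᵥ) - d)))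
      ≡⟨ cong (λ y → c * (xᵤ * M) + ((- 1#) * c * (xᵥ * M) + ((- 1#) * (c * d) * M + eval p x * y))) linear ⟩
    c * (xᵤ * M) + ((- 1#) * c * (xᵥ * M) + ((- 1#) * (c * d) * M + eval p x * ((xᵤ + (- 1#) * xᵥ) + (- 1#) * d)))
      ≡⟨ solve 7 (λ c xᵤ xᵥ d M m R →
                    c :* (xᵤ :* M) :+ (m :* c :* (xᵥ :* M) :+ (m :* (c :* d) :* M :+ R :* ((xᵤ :+ m :* xᵥ) :+ m :* d)))
                                      := (c :* M :+ R) :* ((xᵤ :+ m :* xᵥ) :+ m :* d))
               refl c xᵤ xᵥ d M (- 1#) (eval p x) ⟩
    (c * M + eval p x) * ((xᵤ + (- 1#) * xᵥ) + (- 1#) * d)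
      ≡⟨ cong ((c * M + eval p x) *_) (sym linear) ⟩
    (c * M + eval p x) * ((xᵤ - xᵥ) - d)
      ∎
    where
    open ≡-Reasoning
    xᵤ = lookup x u
    xᵥ = lookup x v
    M = monomial e x
    linear : (xᵤ - xᵥ) - d ≡ (xᵤ + (- 1#) * xᵥ) + (- 1#) * d
    linear = cong₂ (λ y z → (xᵤ + y) + z) (-x≡-1*x xᵥ) (-x≡-1*x d)

  edgePolynomial : ∀ {n} → List (Fin n × Fin n) → (Fin n → Fin n → Carrier) → Polynomial n
  edgePolynomial []             d = (1# , λ _ → 0) ∷ []
  edgePolynomial ((u , v) ∷ es) d = timesLinear u v (d u v) (edgePolynomial es d)

  edgeFactor : ∀ {n} → (Fin n → Fin n → Carrier) → Vec Carrier n → Fin n × Fin n → Carrier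
  edgeFactor d x (u , v) = (lookup x u - lookup x v) - d u v

  edgeFactor≢0 : ∀ {n} d (x : Vec Carrier n) {u v} → edgeFactor d x (u , v) ≢ 0# → lookup x u - lookup x v ≢ d u v
  edgeFactor≢0 d x ≢0 = ≢0 ∘ x≡y⇒x-y≡0

  eval-edgePolynomial : ∀ {n} es d (x : Vec Carrier n) → eval (edgePolynomial es d) x ≡ ∏ es (edgeFactor d x)
  eval-edgePolynomial {n} [] d x = trans (+-identityʳ _) (trans (*-identityˡ _) (product-ones n))
  eval-edgePolynomial ((u , v) ∷ es) d x = begin
    eval (timesLinear u v (d u v) (edgePolynomial es d)) x     ≡⟨ eval-timesLinear u v (d u v) (edgePolynomial es d) x ⟩
    eval (edgePolynomial es d) x * edgeFactor d x (u , v)      ≡⟨ cong (_* edgeFactor d x (u , v)) (eval-edgePolynomial es d x) ⟩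
    ∏ es (edgeFactor d x) * edgeFactor d x (u , v)             ≡⟨ *-comm _ _ ⟩
    ∏ ((u , v) ∷ es) (edgeFactor d x)                          ∎
    where open ≡-Reasoning

  AgreeAtTop : ∀ {n} → ℕ → Term n → Term n → Set
  AgreeAtTop m (c , e) (c′ , e′) = e ≡ e′ × degree e ℕ.≤ m × (degree e ≡ m → c ≡ c′)

  timesLinear-agree : ∀ {n m} u v d d′ {p p′ : Polynomial n} → Pointwise (AgreeAtTop m) p p′ →
    Pointwise (AgreeAtTop (suc m)) (timesLinear u v d p) (timesLinear u v d′ p′)
  timesLinear-agree u v d d′ [] = []
  timesLinear-agree u v d d′ {(_ , e) ∷ _} ((refl , e≤m , c≡c′) ∷ agree) =
    (refl , raised u , c≡c′ ∘ top u) ∷ (refl , raised v , cong ((- 1#) *_) ∘ c≡c′ ∘ top v)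
      ∷ (refl , ℕ.m≤n⇒m≤1+n e≤m , λ e≡1+m → ⊥-elim (ℕ.<⇒≢ (s≤s e≤m) e≡1+m)) ∷ timesLinear-agree u v d d′ agree
    where
    raised : ∀ w → degree (updateAt e w suc) ℕ.≤ suc _
    raised w = subst (ℕ._≤ _) (sym (degree-updateAt w e)) (s≤s e≤m)
    top : ∀ w → degree (updateAt e w suc) ≡ suc _ → degree e ≡ _
    top w ≡1+m = ℕ.suc-injective (trans (sym (degree-updateAt w e)) ≡1+m)

  edgePolynomial-agree : ∀ {n} (es : List (Fin n × Fin n)) d d′ →
    Pointwise (AgreeAtTop (length es)) (edgePolynomial es d) (edgePolynomial es d′)
  edgePolynomial-agree {n} [] d d′ = (refl , ℕ.≤-reflexive (degree-zero n) , λ _ → refl) ∷ []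
  edgePolynomial-agree ((u , v) ∷ es) d d′ = timesLinear-agree u v (d u v) (d′ u v) (edgePolynomial-agree es d d′)

  record Grid {n} (k : Monomial n) : Set where
    constructor grid
    field
      nodes        : Fin n → List Carrier
      nodes-unique : ∀ v → Unique (nodes v)
      nodes-length : ∀ v → length (nodes v) ≡ suc (k v)

    powers : ∀ v → DividedDifferencesOfPowers (k v) (nodes v)
    powers v = dividedDifferencesOfPowers (k v) (nodes v) (nodes-unique v) (nodes-length v)

    gridDifference-below : ∀ e v → e v ℕ.< k v → gridDifference nodes e ≡ 0#
    gridDifference-below e v e<k = product-zero _ v (proj₁ (powers v) _ e<k)

    gridDifference-top : gridDifference nodes k ≡ 1#
    gridDifference-top = trans (product-cong (proj₂ ∘ powers)) (product-ones n)

  open Grid using (nodes)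

  termWeightedSum-agree : ∀ {n} {k : Monomial n} (A B : Grid k) {τ τ′} → AgreeAtTop (degree k) τ τ′ →
    termWeightedSum (nodes A) τ ≡ termWeightedSum (nodes B) τ′
  termWeightedSum-agree {k = k} A B {c , e} {c′ , _} (refl , e≤k , c≡c′) with Fin.any? (λ v → e v ℕ.<? k v)
  ... | yes (v , e<k) = begin
    c * gridDifference (nodes A) e     ≡⟨ cong (c *_) (Grid.gridDifference-below A e v e<k) ⟩
    c * 0#                             ≡⟨ zeroʳ c ⟩
    0#                                 ≡⟨ sym (zeroʳ c′) ⟩
    c′ * 0#                            ≡⟨ cong (c′ *_) (sym (Grid.gridDifference-below B e v e<k)) ⟩
    c′ * gridDifference (nodes B) e    ∎
    where open ≡-Reasoning
  ... | no ¬e<k = begin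
    c * gridDifference (nodes A) e     ≡⟨ cong₂ _*_ (c≡c′ (degree-cong e≡k)) (gridDifference-cong (nodes A) e≡k) ⟩
    c′ * gridDifference (nodes A) k    ≡⟨ cong (c′ *_) (trans (Grid.gridDifference-top A) (sym (Grid.gridDifference-top B))) ⟩
    c′ * gridDifference (nodes B) k    ≡⟨ cong (c′ *_) (gridDifference-cong (nodes B) (sym ∘ e≡k)) ⟩
    c′ * gridDifference (nodes B) e    ∎
    where
    open ≡-Reasoning
    e≡k : ∀ v → e v ≡ k v
    e≡k = degree-squeeze (λ v → ℕ.≮⇒≥ (λ e<k → ¬e<k (v , e<k))) e≤k

  weightedSum-agree : ∀ {n} {k : Monomial n} (A B : Grid k) {p p′} → Pointwise (AgreeAtTop (degree k)) p p′ →
    weightedSum (nodes A) (eval p) ≡ weightedSum (nodes B) (eval p′)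
  weightedSum-agree A B {p} {p′} agree =
    trans (weightedSum-eval (nodes A) p) (trans (∑-agree agree) (sym (weightedSum-eval (nodes B) p′)))
    where
    ∑-agree : ∀ {q q′} → Pointwise (AgreeAtTop _) q q′ → ∑ q (termWeightedSum (nodes A)) ≡ ∑ q′ (termWeightedSum (nodes B))
    ∑-agree []                = refl
    ∑-agree (τ∼τ′ ∷ q∼q′)     = cong₂ _+_ (termWeightedSum-agree A B τ∼τ′) (∑-agree q∼q′)

  edgePolynomial-nonvanishing : ∀ {n} {k : Monomial n} (A B : Grid k) es → degree k ≡ length es → ∀ d d′ →
    weightedSum (nodes B) (eval (edgePolynomial es d′)) ≢ 0# →
    Σ (Vec Carrier n) λ x → OnGrid (nodes A) x × ∏ es (edgeFactor d x) ≢ 0#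
  edgePolynomial-nonvanishing A B es degree≡ d d′ sumB≢0 =
    let x , x∈A , Qx*W≢0 = gridSum≢0⇒∃≢0 (nodes A) _ (sumB≢0 ∘ trans (sym sumA≡sumB))
    in  x , x∈A , λ ∏≡0 → Qx*W≢0 (trans (cong (_* gridWeight (nodes A) x) (trans (eval-edgePolynomial es d x) ∏≡0)) (zeroˡ _))
    where
    sumA≡sumB : weightedSum (nodes A) (eval (edgePolynomial es d)) ≡ weightedSum (nodes B) (eval (edgePolynomial es d′))
    sumA≡sumB = weightedSum-agree A B
      (subst (λ m → Pointwise (AgreeAtTop m) (edgePolynomial es d) (edgePolynomial es d′)) (sym degree≡)
             (edgePolynomial-agree es d d′))

elements : ∀ {m} → Subset m → List (Fin m)
elements []          = []
elements (true ∷ p)  = zero ∷ map suc (elements p)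
elements (false ∷ p) = map suc (elements p)

elements-length : ∀ {m} (p : Subset m) → length (elements p) ≡ ∣ p ∣
elements-length []          = refl
elements-length (true ∷ p)  = cong suc (trans (length-map suc (elements p)) (elements-length p))
elements-length (false ∷ p) = trans (length-map suc (elements p)) (elements-length p)

∈-elements⁻ : ∀ {m} (p : Subset m) {x} → x ∈ elements p → x ∈ₛ p
∈-elements⁻ (true ∷ p)  (here refl) = here
∈-elements⁻ (true ∷ p)  (there x∈)  with ∈-map⁻ suc x∈
... | _ , y∈ , refl = there (∈-elements⁻ p y∈)
∈-elements⁻ (false ∷ p) x∈          with ∈-map⁻ suc x∈
... | _ , y∈ , refl = there (∈-elements⁻ p y∈)

∈-elements⁺ : ∀ {m} (p : Subset m) {x} → x ∈ₛ p → x ∈ elements p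
∈-elements⁺ (true ∷ p)  here       = here refl
∈-elements⁺ (true ∷ p)  (there x∈) = there (∈-map⁺ suc (∈-elements⁺ p x∈))
∈-elements⁺ (false ∷ p) (there x∈) = ∈-map⁺ suc (∈-elements⁺ p x∈)

elements-unique : ∀ {m} (p : Subset m) → Unique (elements p)
elements-unique []          = []
elements-unique (true ∷ p)  = All.tabulate zero∉ ∷ Unique.map⁺ Fin.suc-injective (elements-unique p)
  where
  zero∉ : ∀ {x} → x ∈ map suc (elements p) → zero ≢ x
  zero∉ x∈ refl with ∈-map⁻ suc x∈
  ... | _ , _ , ()
elements-unique (false ∷ p) = Unique.map⁺ Fin.suc-injective (elements-unique p)

x∈p⇒∣p∣>0 : ∀ {m} {p : Subset m} {x} → x ∈ₛ p → 0 ℕ.< ∣ p ∣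
x∈p⇒∣p∣>0 here = z<s
x∈p⇒∣p∣>0 {p = inside ∷ p}  (there x∈p) = z<s
x∈p⇒∣p∣>0 {p = outside ∷ p} (there x∈p) = x∈p⇒∣p∣>0 x∈p


module Edges {n : ℕ} (G : Graph n) where

  open Graph G using (adj; adj-sym; adj-irref)

  isEdge : Fin n → Fin n → Bool
  isEdge i j = does (i <? j) ∧ adj i j

  edgesFrom : Fin n → List (Fin n) → List (Fin n × Fin n)
  edgesFrom i []       = []
  edgesFrom i (j ∷ js) = if isEdge i j then (i , j) ∷ edgesFrom i js else edgesFrom i js

  -- Enumerated exactly as edgeCount counts, so that length-edges is immediate.
  edges : List (Fin n × Fin n)
  edges = concatMap (λ i → edgesFrom i (allFin n)) (allFin n)

  length-edgesFrom : ∀ i js → length (edgesFrom i js) ≡ sum (map (λ j → if isEdge i j then 1 else 0) js)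
  length-edgesFrom i []       = refl
  length-edgesFrom i (j ∷ js) with isEdge i j
  ... | true  = cong suc (length-edgesFrom i js)
  ... | false = length-edgesFrom i js

  length-edges : length edges ≡ edgeCount G
  length-edges = go (allFin n)
    where
    go : ∀ is → length (concatMap (λ i → edgesFrom i (allFin n)) is)
              ≡ sum (map (λ i → sum (map (λ j → if isEdge i j then 1 else 0) (allFin n))) is)
    go []       = refl
    go (i ∷ is) = trans (length-++ (edgesFrom i (allFin n))) (cong₂ ℕ._+_ (length-edgesFrom i (allFin n)) (go is))

  isEdge⇒edge : ∀ {i j} → isEdge i j ≡ true → i < j × adj i j ≡ true
  isEdge⇒edge {i} {j} eq = witness (i <? j) (∧-conicalˡ _ _ eq) , ∧-conicalʳ _ _ eq
    where
    witness : ∀ {A : Set} (a? : Dec A) → does a? ≡ true → A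
    witness (yes a) _ = a

  edge⇒isEdge : ∀ {i j} → i < j → adj i j ≡ true → isEdge i j ≡ true
  edge⇒isEdge {i} {j} i<j adj≡true = cong₂ _∧_ (dec-true (i <? j) i<j) adj≡true

  ∈-edgesFrom⁻ : ∀ i js {e} → e ∈ edgesFrom i js → proj₁ e < proj₂ e × adj (proj₁ e) (proj₂ e) ≡ true
  ∈-edgesFrom⁻ i (j ∷ js) e∈ with isEdge i j in eq
  ∈-edgesFrom⁻ i (j ∷ js) (here refl) | true  = isEdge⇒edge eq
  ∈-edgesFrom⁻ i (j ∷ js) (there e∈)  | true  = ∈-edgesFrom⁻ i js e∈
  ∈-edgesFrom⁻ i (j ∷ js) e∈          | false = ∈-edgesFrom⁻ i js e∈

  ∈-edgesFrom⁺ : ∀ {i j} js → j ∈ js → isEdge i j ≡ true → (i , j) ∈ edgesFrom i js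
  ∈-edgesFrom⁺ {i} (j′ ∷ js) j∈ ij with isEdge i j′ in eq
  ∈-edgesFrom⁺ (j′ ∷ js) (here refl) ij | true  = here refl
  ∈-edgesFrom⁺ (j′ ∷ js) (there j∈)  ij | true  = there (∈-edgesFrom⁺ js j∈ ij)
  ∈-edgesFrom⁺ (j′ ∷ js) (here refl) ij | false with () ← trans (sym eq) ij
  ∈-edgesFrom⁺ (j′ ∷ js) (there j∈)  ij | false = ∈-edgesFrom⁺ js j∈ ij

  ∈-edges⁻ : ∀ {e} → e ∈ edges → proj₁ e < proj₂ e × adj (proj₁ e) (proj₂ e) ≡ true
  ∈-edges⁻ e∈ with ∈-concat⁻′ (map (λ i → edgesFrom i (allFin n)) (allFin n)) e∈
  ... | _ , e∈row , row∈ with ∈-map⁻ (λ i → edgesFrom i (allFin n)) row∈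
  ...   | i , _ , refl = ∈-edgesFrom⁻ i (allFin n) e∈row

  ∈-edges⁺ : ∀ {u v} → u < v → adj u v ≡ true → (u , v) ∈ edges
  ∈-edges⁺ {u} {v} u<v uv =
    ∈-concat⁺′ (∈-edgesFrom⁺ (allFin n) (∈-allFin v) (edge⇒isEdge u<v uv)) (∈-map⁺ (λ i → edgesFrom i (allFin n)) (∈-allFin u))

  distinctOnEdges⇒proper : ∀ {A : Set} (x : Fin n → A) → (∀ {e} → e ∈ edges → x (proj₁ e) ≢ x (proj₂ e)) →
    ∀ u v → adj u v ≡ true → x u ≢ x v
  distinctOnEdges⇒proper x distinct u v uv with Fin.<-cmp u v
  ... | tri< u<v _ _ = distinct (∈-edges⁺ u<v uv)
  ... | tri≈ _ refl _ with () ← trans (sym uv) (adj-irref u)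
  ... | tri> _ _ v<u = distinct (∈-edges⁺ v<u (trans (adj-sym v u) uv)) ∘ sym


module Colorings {t : ℕ} (F : FiniteField t) where

  open FieldProperties F
  open ListSums F
  open GridSums F
  open Polynomials F
  open Grid using (nodes; nodes-unique; nodes-length)

  subsetGrid : ∀ {n} {k : Monomial n} (L : Fin n → Subset t) → (∀ v → ∣ L v ∣ ≡ suc (k v)) → Grid k
  subsetGrid L |L|≡ = grid (elements ∘ L) (elements-unique ∘ L) (λ v → trans (elements-length (L v)) (|L|≡ v))

  renameGrid : ∀ {n} {k : Monomial n} (ρ : Fin n → Carrier → Carrier) → (∀ v → Injective _≡_ _≡_ (ρ v)) → Grid k → Grid k
  renameGrid ρ ρ-injective A = grid (λ v → map (ρ v) (nodes A v))
                                    (λ v → Unique.map⁺ (ρ-injective v) (nodes-unique A v))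
                                    (λ v → trans (length-map (ρ v) (nodes A v)) (nodes-length A v))

  module _ {n} (G : Graph n) where

    open Edges G

    uniqueColoring⇒weightedSum≢0 : (P : ListAssignment n t) {k : Monomial n} (|P|≡ : ∀ v → ∣ P v ∣ ≡ suc (k v)) →
      HasUniqueProperColoring G P → weightedSum (nodes (subsetGrid P |P|≡)) (eval (edgePolynomial edges (λ _ _ → 0#))) ≢ 0#
    uniqueColoring⇒weightedSum≢0 P |P|≡ (c , (c∈P , c-proper) , c-unique) = subst (_≢ 0#) (sym supported) Q₀c*W≢0
      where
      A = nodes (subsetGrid P |P|≡)
      Q₀ = eval (edgePolynomial edges (λ _ _ → 0#))
      c⃗ = Vec.tabulate c

      c⃗∈A : OnGrid A c⃗
      c⃗∈A v = subst (_∈ A v) (sym (Vec.lookup∘tabulate c v)) (∈-elements⁺ (P v) (c∈P v))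

      Q₀c⃗≢0 : Q₀ c⃗ ≢ 0#
      Q₀c⃗≢0 = subst (_≢ 0#) (sym (eval-edgePolynomial edges _ c⃗)) (∏≢0 edges _ factor≢0)
        where
        factor≢0 : ∀ {e} → e ∈ edges → edgeFactor (λ _ _ → 0#) c⃗ e ≢ 0#
        factor≢0 {u , v} e∈ = x≢y⇒x-y≢0 (x≢y⇒x-y≢0 (λ cu≡cv →
          c-proper u v (proj₂ (∈-edges⁻ e∈)) (trans (sym (Vec.lookup∘tabulate c u)) (trans cu≡cv (Vec.lookup∘tabulate c v)))))

      Q₀c*W≢0 : Q₀ c⃗ * gridWeight A c⃗ ≢ 0#
      Q₀c*W≢0 = x*y≢0 Q₀c⃗≢0 (gridWeight≢0 A c⃗)

      Q₀≢0⇒≡c⃗ : ∀ {x} → OnGrid A x → Q₀ x ≢ 0# → x ≡ c⃗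
      Q₀≢0⇒≡c⃗ {x} x∈A Q₀x≢0 = trans (sym (Vec.tabulate∘lookup x)) (Vec.tabulate-cong (c-unique (lookup x) proper))
        where
        distinct : ∀ {e} → e ∈ edges → lookup x (proj₁ e) ≢ lookup x (proj₂ e)
        distinct e∈ = edgeFactor≢0 _ x (∏≢0⇒≢0 _ (subst (_≢ 0#) (eval-edgePolynomial edges _ x) Q₀x≢0) e∈) ∘ x≡y⇒x-y≡0
        proper : IsProperColoring G P (lookup x)
        proper = (λ v → ∈-elements⁻ (P v) (x∈A v)) , distinctOnEdges⇒proper (lookup x) distinct

      supported : weightedSum A Q₀ ≡ Q₀ c⃗ * gridWeight A c⃗
      supported = gridSum-supported-at A _ (nodes-unique (subsetGrid P |P|≡)) c⃗∈A off-c⃗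
        where
        off-c⃗ : ∀ {x} → OnGrid A x → x ≢ c⃗ → Q₀ x * gridWeight A x ≡ 0#
        off-c⃗ {x} x∈A x≢c⃗ with Q₀ x ≟ 0#
        ... | yes Q₀x≡0 = trans (cong (_* gridWeight A x) Q₀x≡0) (zeroˡ _)
        ... | no Q₀x≢0  = ⊥-elim (x≢c⃗ (Q₀≢0⇒≡c⃗ x∈A Q₀x≢0))

    module _ (H : PrimeCover G t) (good : IsGood F H) where

      open PrimeCover H using (L; adjH; adjH-sym; adjH-irref; over-edges)

      ρ : Fin n → Carrier → Carrier
      ρ = proj₁ good

      difference : Fin n → Fin n → Carrier
      difference u v with u <? v | Graph.adj G u v Bool.≟ true
      ... | yes u<v | yes uv = proj₁ (proj₂ (proj₂ good) u v u<v uv)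
      ... | _       | _      = 0#

      difference-spec : ∀ {u v q r} → u < v → adjH u q v r ≡ true → ρ u q - ρ v r ≡ difference u v
      difference-spec {u} {v} {q} {r} u<v qr with u <? v | Graph.adj G u v Bool.≟ true
      ... | yes u<v′ | yes uv = proj₂ (proj₂ (proj₂ good) u v u<v′ uv) q r qr
      ... | yes _    | no ¬uv = ⊥-elim (¬uv (over-edges u q v r qr (Fin.<⇒≢ u<v)))
      ... | no ¬u<v  | _      = ⊥-elim (¬u<v u<v)

      coverGrid : ∀ {k : Monomial n} → (∀ v → ∣ L v ∣ ≡ suc (k v)) → Grid k
      coverGrid |L|≡ = renameGrid ρ (proj₁ (proj₂ good)) (subsetGrid L |L|≡)

      nonvanishing⇒HColoring : ∀ {k : Monomial n} (|L|≡ : ∀ v → ∣ L v ∣ ≡ suc (k v)) x →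
        OnGrid (nodes (coverGrid |L|≡)) x → ∏ edges (edgeFactor difference x) ≢ 0# → HasHColoring H
      nonvanishing⇒HColoring |L|≡ x x∈A ∏≢0 =
        S , Unique.map⁺ (cong proj₁) (Unique.allFin⁺ n) , All.tabulate inH , independent , trans (length-map _ (allFin n)) (length-tabulate id)
        where
        choice : ∀ v → Σ (Fin t) λ q → q ∈ elements (L v) × lookup x v ≡ ρ v q
        choice v = ∈-map⁻ (ρ v) (x∈A v)

        q : Fin n → Fin t
        q = proj₁ ∘ choice

        S : List (Fin n × Fin t)
        S = map (λ v → v , q v) (allFin n)

        inH : ∀ {y} → y ∈ S → PrimeCover.InH H y
        inH y∈S with ∈-map⁻ (λ v → v , q v) y∈S
        ... | v , _ , refl = ∈-elements⁻ (L v) (proj₁ (proj₂ (choice v)))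

        no-forward-edge : ∀ {u v} → u < v → adjH u (q u) v (q v) ≢ true
        no-forward-edge {u} {v} u<v uv = edgeFactor≢0 difference x (∏≢0⇒≢0 _ ∏≢0 (∈-edges⁺ u<v adj-uv))
          (trans (cong₂ _-_ (proj₂ (proj₂ (choice u))) (proj₂ (proj₂ (choice v)))) (difference-spec u<v uv))
          where
          adj-uv = over-edges u (q u) v (q v) uv (Fin.<⇒≢ u<v)

        no-edge : ∀ u v → adjH u (q u) v (q v) ≡ false
        no-edge u v with adjH u (q u) v (q v) in uv | Fin.<-cmp u v
        ... | false | _             = refl
        ... | true  | tri< u<v _ _  = ⊥-elim (no-forward-edge u<v uv)
        ... | true  | tri≈ _ refl _ with () ← trans (sym uv) (adjH-irref u (q u))
        ... | true  | tri> _ _ v<u  = ⊥-elim (no-forward-edge v<u (trans (adjH-sym v (q v) u (q u)) uv))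

        independent : ∀ y z → y ∈ S → z ∈ S → PrimeCover.AdjH H y z ≡ false
        independent _ _ y∈S z∈S with ∈-map⁻ (λ v → v , q v) y∈S | ∈-map⁻ (λ v → v , q v) z∈S
        ... | u , _ , refl | v , _ , refl = no-edge u v

open import Data.Nat using (_+_)

proposition2p7 : (n : ℕ) (G : Graph n) (f : Fin n → ℕ) →
    sumF f ≡ n + edgeCount G →
    (t : ℕ) → IsPrimePower t → (F : FiniteField t) →
    (P : ListAssignment n t) → (∀ v → ∣ P v ∣ ≡ f v) →
    HasUniqueProperColoring G P →
    (H : PrimeCover G t) → IsFCover H f → IsGood F H →
    HasHColoring H
proposition2p7 n G f ∑f≡ t _ F P |P|≡f unique@(c , (c∈P , _) , _) H |L|≡f good =
  let x , x∈A , ∏≢0 = edgePolynomial-nonvanishing (coverGrid G H good |L|≡) (subsetGrid P |P|≡) (edges G)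
                        (sumF≡n+m⇒degree≡m f≡1+k (trans ∑f≡ (cong (n +_) (sym (length-edges G)))))
                        (difference G H good) (λ _ _ → 0#) (uniqueColoring⇒weightedSum≢0 G P |P|≡ unique)
  in  nonvanishing⇒HColoring G H good |L|≡ x x∈A ∏≢0
  where
  open FieldProperties F using (0#)
  open Polynomials F using (edgePolynomial-nonvanishing)
  open Colorings F
  open Edges using (edges; length-edges)

  k : Monomial n
  k v = ℕ.pred (f v)

  f≡1+k : ∀ v → f v ≡ suc (k v)
  f≡1+k v = sym (ℕ.suc-pred (f v) {{>-nonZero (subst (0 ℕ.<_) (|P|≡f v) (x∈p⇒∣p∣>0 (c∈P v)))}})

  |P|≡ : ∀ v → ∣ P v ∣ ≡ suc (k v)
  |P|≡ v = trans (|P|≡f v) (f≡1+k v)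

  |L|≡ : ∀ v → ∣ PrimeCover.L H v ∣ ≡ suc (k v)
  |L|≡ v = trans (|L|≡f v) (f≡1+k v)
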